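{- Let $G$ be a transitive permutation group on a finite set $\Omega$, let $\omega\in \Omega$, let $p$ be a prime and let $k$ be an integer coprime to $p$ such that $\exp(G_\omega) = k p^\alpha$ for some $\alpha \ge 1$. Then $o(g) \le k\, \ell(g)$ for every $g\in G$. In particular, if $G_\omega$ is a $p$-group, then every element of $G$ has a regular orbit.
   Context: $\exp(H)$ is the exponent of a group $H$. For a permutation $g$, $o(g)$ is its order and $\ell(g)$ the length of a longest orbit of $\langle g\rangle$; a regular orbit of $g$ is an orbit of $\langle g\rangle$ of length $o(g)$. $G_\omega$ is the stabiliser of $\omega$ in $G$. -}

module Defs where

open import Data.Nat using (ℕ; zero; suc; _<_; _≤_; _*_; _^_)
open import Data.Fin using (Fin)
open import Data.Fin.Permutation using (Permutation′; _⟨$⟩ʳ_; id; flip; _∘ₚ_; _≈_)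
open import Data.Product using (Σ; ∃; _×_)
open import Relation.Binary.PropositionalEquality using (_≡_)
open import Relation.Nullary using (¬_)
open import Function.Bundles using (_⇔_)

-- The finite set Ω is Fin n; Sym(Ω) is Permutation′ n.
Perm : ℕ → Set
Perm n = Permutation′ n

PermSet : ℕ → Set₁
PermSet n = Perm n → Set

record IsPermGroup {n : ℕ} (G : PermSet n) : Set where
  field
    resp : ∀ {g h} → g ≈ h → G g → G h
    has-id : G id
    has-∘ : ∀ {g h} → G g → G h → G (g ∘ₚ h)
    has-inv : ∀ {g} → G g → G (flip g)

Transitive : {n : ℕ} → PermSet n → Set
Transitive {n} G = ∀ (a b : Fin n) → ∃ λ g → G g × g ⟨$⟩ʳ a ≡ b

Stab : {n : ℕ} → PermSet n → Fin n → PermSet n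
Stab G ω g = G g × g ⟨$⟩ʳ ω ≡ ω

act : {n : ℕ} → Perm n → ℕ → Fin n → Fin n
act g zero x = x
act g (suc m) x = g ⟨$⟩ʳ act g m x

PowId : {n : ℕ} → Perm n → ℕ → Set
PowId g m = ∀ x → act g m x ≡ x

IsOrder : {n : ℕ} → Perm n → ℕ → Set
IsOrder g m = 0 < m × PowId g m × (∀ j → 0 < j → j < m → ¬ PowId g j)

IsExponent : {n : ℕ} → PermSet n → ℕ → Set
IsExponent H m =
  0 < m × (∀ h → H h → PowId h m) × (∀ j → 0 < j → j < m → ¬ (∀ h → H h → PowId h j))

InOrbit : {n : ℕ} → Perm n → Fin n → Fin n → Set
InOrbit g x y = ∃ λ i → act g i x ≡ y

OrbitSize : {n : ℕ} → Perm n → Fin n → ℕ → Set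
OrbitSize {n} g x m =
  Σ (Fin m → Fin n) λ f →
    (∀ i j → f i ≡ f j → i ≡ j) × (∀ y → InOrbit g x y ⇔ (∃ λ j → f j ≡ y))

IsLongestOrbit : {n : ℕ} → Perm n → ℕ → Set
IsLongestOrbit g L = (∃ λ x → OrbitSize g x L) × (∀ x m → OrbitSize g x m → m ≤ L)

HasRegularOrbit : {n : ℕ} → Perm n → Set
HasRegularOrbit g = ∃ λ x → ∃ λ m → IsOrder g m × OrbitSize g x m

HasCard : {n : ℕ} → PermSet n → ℕ → Set
HasCard {n} H m =
  Σ (Fin m → Perm n) λ f →
    (∀ j → H (f j)) × (∀ h → H h → ∃ λ j → f j ≈ h) × (∀ i j → f i ≈ f j → i ≡ j)

IsPGroup : {n : ℕ} → ℕ → PermSet n → Set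
IsPGroup p H = ∃ λ a → HasCard H (p ^ a)

module Submission where

-- Let g ∈ G have order o, let d x be the length of the ⟨g⟩-orbit of x and write o = c x · d x.
-- Not every cofactor c x is divisible by p, for otherwise g^(o/p) would already be trivial; fix x
-- with p ∤ c x. Transitivity conjugates g^(d x), which fixes x, into G_ω, so g^(d x · k p^α) = 1;
-- hence c x ∣ k p^α and, being prime to p, c x ∣ k. Thus o = c x · d x ≤ k · d x ≤ k ℓ(g).
-- When G_ω is a p-group, Lagrange's theorem gives h^(p^a) = 1 on G_ω, so the same argument with
-- k = 1 yields d x = o: the orbit of x is regular.

open import Defs
open import Data.Nat
open import Data.Nat.Properties
open import Data.Nat.Divisibility
open import Data.Nat.DivMod
open import Data.Nat.Primality using (Prime; prime⇒irreducible; prime⇒nonTrivial; prime⇒nonZero)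
open import Data.Nat.Coprimality using (Coprime; coprime-divisor; ¬0-coprimeTo-2+)
open import Data.Nat.Induction using (<-rec; <-wellFounded)
open import Data.Fin as Fin using (Fin; toℕ; fromℕ<)
open import Data.Fin.Properties using (pigeonhole; toℕ-injective; toℕ<n; toℕ-fromℕ<; all?; any?; injective⇒≤)
open import Data.Fin.Permutation using (permutation; id; _⟨$⟩ʳ_; _⟨$⟩ˡ_; _∘ₚ_; flip; inverseˡ; inverseʳ)
open import Data.Product
open import Data.Empty using (⊥-elim)
open import Data.Sum using (inj₁; inj₂)
open import Data.List using (List; []; _∷_; length; filter; foldr; applyUpTo; allFin)
open import Data.List.Properties using (filter-accept; filter-reject; filter-all; length-applyUpTo; length-tabulate)
open import Data.List.Membership.Propositional using (_∈_; _∉_)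
open import Data.List.Membership.Propositional.Properties
  using (∈-filter⁺; ∈-filter⁻; ∈-applyUpTo⁺; ∈-applyUpTo⁻; ∈-allFin)
open import Data.List.Relation.Unary.Any using (here; there)
import Data.List.Relation.Unary.All as All
open import Data.List.Relation.Unary.AllPairs using (_∷_)
open import Data.List.Relation.Unary.Unique.Propositional using (Unique)
open import Data.List.Relation.Unary.Unique.Propositional.Properties using (filter⁺; applyUpTo⁺₁; allFin⁺)
open import Function using (_∘′_)
open import Function.Bundles using (mk⇔)
open import Induction.WellFounded using (Acc; acc)
open import Relation.Nullary
open import Relation.Unary using (Decidable)
open import Relation.Nullary.Decidable using (decidable-stable)
open import Relation.Binary.Definitions using (DecidableEquality; tri<; tri≈; tri>)
open import Relation.Binary.PropositionalEquality using (_≡_; _≢_; refl; sym; trans; cong; subst; module ≡-Reasoning)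

Minimal : (ℕ → Set) → ℕ → Set
Minimal P m = 0 < m × P m × (∀ j → 0 < j → j < m → ¬ P j)

minimal-exists : ∀ {P : ℕ → Set} → Decidable P → ∀ {N} → 0 < N → P N → ∃ (Minimal P)
minimal-exists {P} P? {N} = <-rec (λ N → 0 < N → P N → ∃ (Minimal P)) step N
  where
  step : ∀ N → (∀ {j} → j < N → 0 < j → P j → ∃ (Minimal P)) → 0 < N → P N → ∃ (Minimal P)
  step N smaller 0<N PN with anyUpTo? (λ j → 0 <? j ×-dec P? j) N
  ... | yes (j , j<N , 0<j , Pj) = smaller j<N 0<j Pj
  ... | no none = N , 0<N , PN , λ j 0<j j<N Pj → none (j , j<N , 0<j , Pj)

minimal-∣ : ∀ {P : ℕ → Set} {d} .{{_ : NonZero d}} → Minimal P d →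
            (∀ {j} → P j → P (j % d)) → ∀ {j} → P j → d ∣ j
minimal-∣ {P} {d} (_ , _ , below) P-% {j} Pj with j % d in eq
... | zero = m%n≡0⇒n∣m j d eq
... | suc r = ⊥-elim (below (suc r) z<s (subst (_< d) eq (m%n<n j d)) (subst P eq (P-% Pj)))

IsPeriod : ∀ {n} → Perm n → Fin n → ℕ → Set
IsPeriod g x = Minimal (λ j → act g j x ≡ x)

module _ {n : ℕ} (g : Perm n) where

  act-+ : ∀ a b {x} → act g (a + b) x ≡ act g a (act g b x)
  act-+ zero    b = refl
  act-+ (suc a) b = cong (g ⟨$⟩ʳ_) (act-+ a b)

  act-injective : ∀ a {x y} → act g a x ≡ act g a y → x ≡ y
  act-injective zero    eq = eq
  act-injective (suc a) eq = act-injective a (trans (sym (inverseˡ g)) (trans (cong (g ⟨$⟩ˡ_) eq) (inverseˡ g)))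

  fixed-* : ∀ {d x} → act g d x ≡ x → ∀ q → act g (q * d) x ≡ x
  fixed-* fix zero    = refl
  fixed-* {d} fix (suc q) = trans (act-+ d (q * d)) (trans (cong (act g d) (fixed-* fix q)) fix)

  ∣⇒fixed : ∀ {d j x} → act g d x ≡ x → d ∣ j → act g j x ≡ x
  ∣⇒fixed fix (divides q refl) = fixed-* fix q

  act-% : ∀ {d x} .{{_ : NonZero d}} → act g d x ≡ x → ∀ j → act g j x ≡ act g (j % d) x
  act-% {d} {x} fix j = begin
    act g j x                         ≡⟨ cong (λ i → act g i x) (m≡m%n+[m/n]*n j d) ⟩
    act g (j % d + j / d * d) x       ≡⟨ act-+ (j % d) (j / d * d) ⟩
    act g (j % d) (act g (j / d * d) x) ≡⟨ cong (act g (j % d)) (fixed-* fix (j / d)) ⟩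
    act g (j % d) x                   ∎
    where open ≡-Reasoning

  period-∣ : ∀ {x d j} → IsPeriod g x d → act g j x ≡ x → d ∣ j
  period-∣ {d = suc _} per@(_ , fix , _) = minimal-∣ per (λ {j} fixj → trans (sym (act-% fix j)) fixj)

  order-∣ : ∀ {o j} → IsOrder g o → PowId g j → o ∣ j
  order-∣ {suc _} ord@(_ , g^o , _) = minimal-∣ ord (λ {j} g^j x → trans (sym (act-% (g^o x) j)) (g^j x))

  act-∸ : ∀ {i j x} → i ≤ j → act g i (act g (j ∸ i) x) ≡ act g j x
  act-∸ {i} {j} {x} i≤j = trans (sym (act-+ i (j ∸ i))) (cong (λ k → act g k x) (m+[n∸m]≡n i≤j))

  opaque
    period-exists : ∀ x → ∃ (IsPeriod g x)
    period-exists x with pigeonhole (n<1+n n) (λ i → act g (toℕ i) x)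
    ... | i , j , i<j , eq = minimal-exists (λ k → act g k x Fin.≟ x) (m<n⇒0<n∸m i<j)
          (act-injective (toℕ i) (trans (act-∸ (<⇒≤ i<j)) (sym eq)))

  period-distinct : ∀ {x d i j} → IsPeriod g x d → i < j → j < d → act g i x ≢ act g j x
  period-distinct {i = i} {j} (_ , _ , below) i<j j<d eq =
    below (j ∸ i) (m<n⇒0<n∸m i<j) (≤-<-trans (m∸n≤m j i) j<d)
      (act-injective i (trans (act-∸ (<⇒≤ i<j)) (sym eq)))

  period⇒orbitSize : ∀ {x d} → IsPeriod g x d → OrbitSize g x d
  period⇒orbitSize {x} {d@(suc _)} per@(_ , fix , _) =
    orbit , injective , λ y → mk⇔ (into y) (λ (j , eq) → toℕ j , eq)
    where
    orbit : Fin d → Fin n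
    orbit j = act g (toℕ j) x
    injective : ∀ i j → orbit i ≡ orbit j → i ≡ j
    injective i j eq with <-cmp (toℕ i) (toℕ j)
    ... | tri< i<j _ _ = ⊥-elim (period-distinct per i<j (toℕ<n j) eq)
    ... | tri≈ _ i≡j _ = toℕ-injective i≡j
    ... | tri> _ _ j<i = ⊥-elim (period-distinct per j<i (toℕ<n i) (sym eq))
    into : ∀ y → InOrbit g x y → ∃ λ j → orbit j ≡ y
    into y (i , eq) = fromℕ< (m%n<n i d) ,
      trans (cong (λ k → act g k x) (toℕ-fromℕ< (m%n<n i d))) (trans (sym (act-% fix i)) eq)

  period≤n : ∀ {x d} → IsPeriod g x d → d ≤ n
  period≤n per with period⇒orbitSize per
  ... | _ , injective , _ = injective⇒≤ (injective _ _)

  opaque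
    order-exists : ∃ (IsOrder g)
    order-exists = minimal-exists (λ j → all? (λ x → act g j x Fin.≟ x)) (1≤n! n) n!-fixes
      where
      n!-fixes : PowId g (n !)
      n!-fixes x with period-exists x
      ... | suc k , per@(_ , fix , _) =
        ∣⇒fixed fix (∣-trans (m∣m*n {suc k} (k !)) (m≤n⇒m!∣n! (period≤n per)))

order-∣-period⇒regular : ∀ {n} (g : Perm n) {o x d} →
                         IsOrder g o → IsPeriod g x d → o ∣ d → HasRegularOrbit g
order-∣-period⇒regular g {x = x} ord@(_ , g^o , _) per o∣d =
  x , _ , ord , subst (OrbitSize g x) (∣-antisym (period-∣ g per (g^o x)) o∣d) (period⇒orbitSize g per)

module _ {A : Set} (_≟_ : DecidableEquality A) where

  remove : A → List A → List A
  remove o = filter (λ z → ¬? (z ≟ o))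

  length-remove : ∀ {o S} → o ∈ S → Unique S → suc (length (remove o S)) ≡ length S
  length-remove {o} {o ∷ S} (here refl) (o∉S ∷ _) =
    cong suc (trans (cong length (filter-reject (λ z → ¬? (z ≟ o)) (λ o≢o → o≢o refl)))
                    (cong length (filter-all (λ z → ¬? (z ≟ o)) (All.map (λ o≢z → o≢z ∘′ sym) o∉S))))
  length-remove {o} {y ∷ S} (there o∈S) (y∉S ∷ u) =
    trans (cong (suc ∘′ length) (filter-accept (λ z → ¬? (z ≟ o)) (All.lookup y∉S o∈S)))
          (cong suc (length-remove o∈S u))

  removeAll : List A → List A → List A
  removeAll O S = foldr remove S O

  ∈-removeAll⁻ : ∀ O {S z} → z ∈ removeAll O S → z ∈ S × z ∉ O
  ∈-removeAll⁻ []      z∈ = z∈ , λ ()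
  ∈-removeAll⁻ (o ∷ O) z∈ with ∈-filter⁻ (λ z → ¬? (z ≟ o)) z∈
  ... | z∈' , z≢o with ∈-removeAll⁻ O z∈'
  ...   | z∈S , z∉O = z∈S , λ { (here z≡o) → z≢o z≡o ; (there z∈O) → z∉O z∈O }

  ∈-removeAll⁺ : ∀ O {S z} → z ∈ S → z ∉ O → z ∈ removeAll O S
  ∈-removeAll⁺ []      z∈S _   = z∈S
  ∈-removeAll⁺ (o ∷ O) z∈S z∉O =
    ∈-filter⁺ (λ z → ¬? (z ≟ o)) (∈-removeAll⁺ O z∈S (z∉O ∘′ there)) (z∉O ∘′ here)

  removeAll⁺ : ∀ O {S} → Unique S → Unique (removeAll O S)
  removeAll⁺ []      u = u
  removeAll⁺ (o ∷ O) u = filter⁺ (λ z → ¬? (z ≟ o)) (removeAll⁺ O u)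

  length-removeAll : ∀ {O S} → Unique O → (∀ {z} → z ∈ O → z ∈ S) → Unique S →
                     length (removeAll O S) + length O ≡ length S
  length-removeAll {[]}    {S} _      _   _  = +-identityʳ (length S)
  length-removeAll {o ∷ O} {S} (o∉O ∷ uO) O⊆S uS = begin
    length (remove o (removeAll O S)) + suc (length O) ≡⟨ +-suc _ (length O) ⟩
    suc (length (remove o (removeAll O S))) + length O ≡⟨ cong (_+ length O) (length-remove o∈ (removeAll⁺ O uS)) ⟩
    length (removeAll O S) + length O                 ≡⟨ length-removeAll uO (O⊆S ∘′ there) uS ⟩
    length S                                          ∎
    where
    open ≡-Reasoning
    o∈ : o ∈ removeAll O _
    o∈ = ∈-removeAll⁺ O (O⊆S (here refl)) (λ o∈O → All.lookup o∉O o∈O refl)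

module _ {N : ℕ} (π : Perm N) {r : ℕ} (uniform : ∀ x → IsPeriod π x r) where

  private
    orbit : Fin N → List (Fin N)
    orbit x = applyUpTo (λ j → act π j x) r

    Closed : List (Fin N) → Set
    Closed S = ∀ {z} → z ∈ S → π ⟨$⟩ʳ z ∈ S

    0<r : Fin N → 0 < r
    0<r x = proj₁ (uniform x)

    ∈-orbit : ∀ j x → act π j x ∈ orbit x
    ∈-orbit j x = subst (_∈ orbit x) (sym (act-% π (proj₁ (proj₂ (uniform x))) j)) (∈-applyUpTo⁺ _ (m%n<n j r))
      where
      instance
        r≢0 : NonZero r
        r≢0 = >-nonZero (0<r x)

    ∈-orbit⁻¹ : ∀ {x z} → π ⟨$⟩ʳ z ∈ orbit x → z ∈ orbit x
    ∈-orbit⁻¹ {x} {z} πz∈ with ∈-applyUpTo⁻ _ πz∈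
    ... | j , _ , πz≡ = subst (_∈ orbit x) z≡ (∈-orbit (r ∸ 1 + j) x)
      where
      open ≡-Reasoning
      z≡ : act π (r ∸ 1 + j) x ≡ z
      z≡ = begin
        act π (r ∸ 1 + j) x      ≡⟨ act-+ π (r ∸ 1) j ⟩
        act π (r ∸ 1) (act π j x) ≡⟨ cong (act π (r ∸ 1)) πz≡ ⟨
        act π (r ∸ 1) (act π 1 z) ≡⟨ act-+ π (r ∸ 1) 1 ⟨
        act π (r ∸ 1 + 1) z      ≡⟨ cong (λ k → act π k z) (m∸n+n≡m (0<r x)) ⟩
        act π r z                ≡⟨ proj₁ (proj₂ (uniform z)) ⟩
        z                        ∎

    orbit⊆ : ∀ {S x} → Closed S → x ∈ S → ∀ {z} → z ∈ orbit x → z ∈ S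
    orbit⊆ {S} {x} closed x∈S z∈ with ∈-applyUpTo⁻ _ z∈
    ... | j , _ , refl = act-∈ j
      where
      act-∈ : ∀ j → act π j x ∈ S
      act-∈ zero    = x∈S
      act-∈ (suc j) = closed (act-∈ j)

    divides-closed : ∀ S → Acc _<_ (length S) → Unique S → Closed S → r ∣ length S
    divides-closed []          _        _ _      = r ∣0
    divides-closed S@(x ∷ _) (acc rec) u closed =
      subst (r ∣_) length-S
        (∣m∣n⇒∣m+n (divides-closed S' (rec shorter) (removeAll⁺ Fin._≟_ O u) closed') ∣-refl)
      where
      O  = orbit x
      S' = removeAll Fin._≟_ O S
      length-S : length S' + r ≡ length S
      length-S = trans (cong (length S' +_) (sym (length-applyUpTo _ r)))
        (length-removeAll Fin._≟_ (applyUpTo⁺₁ _ r (λ i<j j<r → period-distinct π (uniform x) i<j j<r))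
                                   (orbit⊆ closed (here refl)) u)
      shorter : length S' < length S
      shorter = subst (length S' <_) length-S (m<m+n (length S') (0<r x))
      closed' : Closed S'
      closed' z∈ with ∈-removeAll⁻ Fin._≟_ O z∈
      ... | z∈S , z∉O = ∈-removeAll⁺ Fin._≟_ O (closed z∈S) (z∉O ∘′ ∈-orbit⁻¹)

  common-period-∣ : r ∣ N
  common-period-∣ = subst (r ∣_) (length-tabulate _)
    (divides-closed (allFin N) (<-wellFounded _) (allFin⁺ N) (λ _ → ∈-allFin _))

lagrange : ∀ {n N} {H : PermSet n} → IsPermGroup H → HasCard H N → ∀ {h} → H h → PowId h N
lagrange {N = N} {H} isGroup (f , f∈H , onto , f-injective) {h} h∈H x with order-exists h
... | o , ord@(0<o , h^o , below) = ∣⇒fixed h (h^o x) (common-period-∣ ρ period)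
  where
  open IsPermGroup isGroup

  index : ∀ {g} → H g → Fin N
  index g∈H = proj₁ (onto _ g∈H)

  index-≈ : ∀ {g} (g∈H : H g) y → f (index g∈H) ⟨$⟩ʳ y ≡ g ⟨$⟩ʳ y
  index-≈ g∈H = proj₂ (onto _ g∈H)

  -- Right multiplication by h on the enumeration f of H; it acts freely, so every orbit has length o(h).
  ρ : Perm N
  ρ = permutation (λ i → index (has-∘ (f∈H i) h∈H)) (λ i → index (has-∘ (f∈H i) (has-inv h∈H)))
    (λ i → f-injective _ _ λ y → trans (index-≈ _ y) (trans (cong (h ⟨$⟩ʳ_) (index-≈ _ y)) (inverseʳ h)))
    (λ i → f-injective _ _ λ y → trans (index-≈ _ y) (trans (cong (h ⟨$⟩ˡ_) (index-≈ _ y)) (inverseˡ h)))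

  act-ρ : ∀ j i y → f (act ρ j i) ⟨$⟩ʳ y ≡ act h j (f i ⟨$⟩ʳ y)
  act-ρ zero    i y = refl
  act-ρ (suc j) i y = trans (index-≈ _ y) (cong (h ⟨$⟩ʳ_) (act-ρ j i y))

  period : ∀ i → IsPeriod ρ i o
  period i = 0<o , f-injective _ _ (λ y → trans (act-ρ o i y) (h^o _)) ,
             λ j 0<j j<o ρ^j → below j 0<j j<o (identity {j} ρ^j)
    where
    identity : ∀ {j} → act ρ j i ≡ i → PowId h j
    identity {j} fix z = begin
      act h j z                           ≡⟨ cong (act h j) (inverseʳ (f i)) ⟨
      act h j (f i ⟨$⟩ʳ (f i ⟨$⟩ˡ z))       ≡⟨ act-ρ j i _ ⟨
      f (act ρ j i) ⟨$⟩ʳ (f i ⟨$⟩ˡ z)       ≡⟨ cong (λ k → f k ⟨$⟩ʳ (f i ⟨$⟩ˡ z)) fix ⟩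
      f i ⟨$⟩ʳ (f i ⟨$⟩ˡ z)                 ≡⟨ inverseʳ (f i) ⟩
      z                                   ∎
      where open ≡-Reasoning

pow : ∀ {n} → Perm n → ℕ → Perm n
pow g zero    = id
pow g (suc m) = pow g m ∘ₚ g

pow-act : ∀ {n} (g : Perm n) d {y} → pow g d ⟨$⟩ʳ y ≡ act g d y
pow-act g zero    = refl
pow-act g (suc d) = cong (g ⟨$⟩ʳ_) (pow-act g d)

act-pow : ∀ {n} (g : Perm n) d m {x} → act (pow g d) m x ≡ act g (m * d) x
act-pow g d zero    = refl
act-pow g d (suc m) = trans (pow-act g d) (trans (cong (act g d) (act-pow g d m)) (sym (act-+ g d (m * d))))

act-conj : ∀ {n} (t a : Perm n) m {y} → act (t ∘ₚ a ∘ₚ flip t) m y ≡ t ⟨$⟩ˡ act a m (t ⟨$⟩ʳ y)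
act-conj t a zero    = sym (inverseˡ t)
act-conj t a (suc m) = trans (cong (λ z → t ⟨$⟩ˡ (a ⟨$⟩ʳ (t ⟨$⟩ʳ z))) (act-conj t a m))
                             (cong (λ z → t ⟨$⟩ˡ (a ⟨$⟩ʳ z)) (inverseʳ t))

PowId-conj : ∀ {n} (t a : Perm n) {m} → PowId (t ∘ₚ a ∘ₚ flip t) m → PowId a m
PowId-conj t a {m} conj^m z = begin
  act a m z                           ≡⟨ cong (act a m) (inverseʳ t) ⟨
  act a m (t ⟨$⟩ʳ (t ⟨$⟩ˡ z))           ≡⟨ inverseʳ t ⟨
  t ⟨$⟩ʳ (t ⟨$⟩ˡ act a m (t ⟨$⟩ʳ (t ⟨$⟩ˡ z))) ≡⟨ cong (t ⟨$⟩ʳ_) (act-conj t a m) ⟨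
  t ⟨$⟩ʳ act (t ∘ₚ a ∘ₚ flip t) m (t ⟨$⟩ˡ z) ≡⟨ cong (t ⟨$⟩ʳ_) (conj^m _) ⟩
  t ⟨$⟩ʳ (t ⟨$⟩ˡ z)                     ≡⟨ inverseʳ t ⟩
  z                                   ∎
  where open ≡-Reasoning

module _ {n} {G : PermSet n} (isGroup : IsPermGroup G) where
  open IsPermGroup isGroup

  pow-∈ : ∀ {g} → G g → ∀ m → G (pow g m)
  pow-∈ g∈G zero    = has-id
  pow-∈ g∈G (suc m) = has-∘ (pow-∈ g∈G m) g∈G

  stab-isPermGroup : ∀ ω → IsPermGroup (Stab G ω)
  stab-isPermGroup ω = record
    { resp    = λ g≈h (g∈G , gω) → resp g≈h g∈G , trans (sym (g≈h ω)) gω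
    ; has-id  = has-id , refl
    ; has-∘   = λ {_} {h} (g∈G , gω) (h∈G , hω) → has-∘ g∈G h∈G , trans (cong (h ⟨$⟩ʳ_) gω) hω
    ; has-inv = λ {g} (g∈G , gω) → has-inv g∈G , trans (cong (g ⟨$⟩ˡ_) (sym gω)) (inverseˡ g)
    }

  order-∣-*-period : Transitive G → ∀ ω {E} → (∀ h → Stab G ω h → PowId h E) →
                     ∀ {g o x d} → G g → IsOrder g o → act g d x ≡ x → o ∣ E * d
  order-∣-*-period transitive ω {E} annihilates {g} {o} {x} {d} g∈G ord fix with transitive ω x
  ... | t , t∈G , tω = order-∣ g ord λ z →
    trans (sym (act-pow g d E)) (PowId-conj t (pow g d) {E} (annihilates _ h∈Stab) z)
    where
    h∈Stab : Stab G ω (t ∘ₚ pow g d ∘ₚ flip t)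
    h∈Stab = has-∘ t∈G (has-∘ (pow-∈ g∈G d) (has-inv t∈G)) , (begin
      t ⟨$⟩ˡ (pow g d ⟨$⟩ʳ (t ⟨$⟩ʳ ω)) ≡⟨ cong (λ y → t ⟨$⟩ˡ (pow g d ⟨$⟩ʳ y)) tω ⟩
      t ⟨$⟩ˡ (pow g d ⟨$⟩ʳ x)          ≡⟨ cong (t ⟨$⟩ˡ_) (trans (pow-act g d) fix) ⟩
      t ⟨$⟩ˡ x                         ≡⟨ cong (t ⟨$⟩ˡ_) tω ⟨
      t ⟨$⟩ˡ (t ⟨$⟩ʳ ω)                ≡⟨ inverseˡ t ⟩
      ω                               ∎)
      where open ≡-Reasoning

¬∣⇒coprime : ∀ {p c} → Prime p → ¬ p ∣ c → Coprime c p
¬∣⇒coprime p-prime p∤c (i∣c , i∣p) with prime⇒irreducible p-prime i∣p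
... | inj₁ i≡1 = i≡1
... | inj₂ refl = ⊥-elim (p∤c i∣c)

coprime-∣-^* : ∀ {c p} α k → Coprime c p → c ∣ p ^ α * k → c ∣ k
coprime-∣-^* {c}     zero    k _      c∣ = subst (c ∣_) (+-identityʳ k) c∣
coprime-∣-^* {c} {p} (suc α) k c⊥p c∣ =
  coprime-∣-^* α k c⊥p (coprime-divisor c⊥p (subst (c ∣_) (*-assoc p (p ^ α) k) c∣))

module _ {n} {g : Perm n} {o} (ord : IsOrder g o) where

  period : Fin n → ℕ
  period x = proj₁ (period-exists g x)

  period-fixes : ∀ x → act g (period x) x ≡ x
  period-fixes x = proj₁ (proj₂ (proj₂ (period-exists g x)))

  period-∣-order : ∀ x → period x ∣ o
  period-∣-order x = period-∣ g (proj₂ (period-exists g x)) (proj₁ (proj₂ ord) x)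

  cofactor : Fin n → ℕ
  cofactor x = _∣_.quotient (period-∣-order x)

  cofactor-* : ∀ x → cofactor x * period x ≡ o
  cofactor-* x = sym (_∣_.equality (period-∣-order x))

  cofactor-∣-order : ∀ x → cofactor x ∣ o
  cofactor-∣-order x = subst (cofactor x ∣_) (cofactor-* x) (m∣m*n (period x))

  -- If p divided every cofactor, g^(o/p) would fix every point.
  ¬all-cofactors-divisible : ∀ {p} → Prime p → Fin n → ¬ (∀ x → p ∣ cofactor x)
  ¬all-cofactors-divisible {p} p-prime ω p∣c with ∣-trans (p∣c ω) (cofactor-∣-order ω)
  ... | divides q o≡q*p = below q 0<q q<o λ x → ∣⇒fixed g (period-fixes x) (period-∣-q x)
    where
    0<o = proj₁ ord
    below = proj₂ (proj₂ ord)
    0<q : 0 < q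
    0<q = n≢0⇒n>0 λ { refl → <-irrefl (sym o≡q*p) 0<o }
    q<o : q < o
    q<o = subst (q <_) (sym o≡q*p) (m<m*n q p {{>-nonZero 0<q}} (nonTrivial⇒n>1 p {{prime⇒nonTrivial p-prime}}))
    period-∣-q : ∀ x → period x ∣ q
    period-∣-q x = *-cancelʳ-∣ p {{prime⇒nonZero p-prime}} (subst (period x * p ∣_) (trans (cofactor-* x) o≡q*p)
      (subst (period x * p ∣_) (*-comm (period x) (cofactor x)) (*-monoʳ-∣ (period x) (p∣c x))))

  p-free-cofactor : ∀ {p} → Prime p → Fin n → ∃ λ x → ¬ p ∣ cofactor x
  p-free-cofactor {p} p-prime ω with any? (λ x → ¬? (p ∣? cofactor x))
  ... | yes found = found
  ... | no  none  = ⊥-elim (¬all-cofactors-divisible p-prime ω λ x →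
                      decidable-stable (p ∣? cofactor x) λ p∤c → none (x , p∤c))

coprime-to-prime⇒nonZero : ∀ {k p} → Prime p → Coprime k p → NonZero k
coprime-to-prime⇒nonZero {zero}  p-prime k⊥p = ⊥-elim (¬0-coprimeTo-2+ {{prime⇒nonTrivial p-prime}} k⊥p)
coprime-to-prime⇒nonZero {suc _} _       _   = _

module _ {n} {G : PermSet n} (isGroup : IsPermGroup G) (transitive : Transitive G) (ω : Fin n)
         {p} (p-prime : Prime p) (k α : ℕ) (annihilates : ∀ h → Stab G ω h → PowId h (k * p ^ α)) where

  ∃-order-∣-k*period : ∀ {g o} → G g → IsOrder g o → ∃₂ λ x d → IsPeriod g x d × o ∣ k * d
  ∃-order-∣-k*period {g} {o} g∈G ord with p-free-cofactor ord p-prime ω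
  ... | x , p∤c = x , d , per , subst (_∣ k * d) (cofactor-* ord x) (*-monoˡ-∣ d c∣k)
    where
    d = period ord x
    c = cofactor ord x
    per = proj₂ (period-exists g x)
    c∣k*p^α : c ∣ k * p ^ α
    c∣k*p^α = *-cancelʳ-∣ d {{>-nonZero (proj₁ per)}} (subst (_∣ k * p ^ α * d) (sym (cofactor-* ord x))
      (order-∣-*-period isGroup transitive ω {k * p ^ α} annihilates {d = d} g∈G ord (period-fixes ord x)))
    c∣k : c ∣ k
    c∣k = coprime-∣-^* α k (¬∣⇒coprime p-prime p∤c) (subst (c ∣_) (*-comm k (p ^ α)) c∣k*p^α)

corollary2p3 : (n : ℕ) (G : PermSet n) → IsPermGroup G → Transitive G → (ω : Fin n)
    → (p : ℕ) → Prime p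
    → ((k α : ℕ) → Coprime k p → 1 ≤ α → IsExponent (Stab G ω) (k * p ^ α)
    → ∀ g → G g → ∀ o L → IsOrder g o → IsLongestOrbit g L → o ≤ k * L)
    × (IsPGroup p (Stab G ω) → ∀ g → G g → HasRegularOrbit g)
corollary2p3 n G isGroup transitive ω p p-prime = bounded , regular
  where
  bounded : (k α : ℕ) → Coprime k p → 1 ≤ α → IsExponent (Stab G ω) (k * p ^ α)
    → ∀ g → G g → ∀ o L → IsOrder g o → IsLongestOrbit g L → o ≤ k * L
  bounded k α k⊥p _ (_ , annihilates , _) g g∈G o L ord (_ , longest)
    with ∃-order-∣-k*period isGroup transitive ω p-prime k α annihilates g∈G ord
  ... | x , d , per , o∣k*d = begin
    o     ≤⟨ ∣⇒≤ o∣k*d ⟩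
    k * d ≤⟨ *-monoʳ-≤ k (longest x d (period⇒orbitSize g per)) ⟩
    k * L ∎
    where
    open ≤-Reasoning
    instance
      k≢0 : NonZero k
      k≢0 = coprime-to-prime⇒nonZero p-prime k⊥p
      d≢0 : NonZero d
      d≢0 = >-nonZero (proj₁ per)
      k*d≢0 : NonZero (k * d)
      k*d≢0 = m*n≢0 k d

  regular : IsPGroup p (Stab G ω) → ∀ g → G g → HasRegularOrbit g
  regular (a , card) g g∈G =
    let o , ord = order-exists g
        x , d , per , o∣1*d = ∃-order-∣-k*period isGroup transitive ω p-prime 1 a annihilates g∈G ord
    in order-∣-period⇒regular g ord per (subst (o ∣_) (*-identityˡ d) o∣1*d)
    where
    annihilates : ∀ h → Stab G ω h → PowId h (1 * p ^ a)
    annihilates h h∈Stab =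
      subst (PowId h) (sym (*-identityˡ (p ^ a))) (lagrange (stab-isPermGroup isGroup ω) card h∈Stab)
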